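{- For all integers $a,b \geq 1$ and all sets $A,B \subseteq \mathbb{Z}$ it holds that \[A^{[a]}\cap B^{[a]} = \left(\bigcup_{i=0}^{b-1} D_i\right)^{[a]},\] where the sets $D_i$ and $Y_i$ are defined recursively for $i=0,\dots,b-1$ by $Y_i = ia + \left(B^{[a]} \setminus \bigcup_{j=0}^{i-1} D_j^{[a]}\right)$ and $D_i = A^{[ab]} \cap Y_i$.
   Context: For an integer $\alpha\ge 1$ and a set $X\subseteq\mathbb{Z}$, $X^{[\alpha]} = \{z \bmod \alpha : z \in X\}\subseteq[0,\alpha)$. For an integer $t$ and a set $X$, $t+X=\{t+z:z\in X\}$. -}

module Defs where

open import Level using (0ℓ)
open import Data.Nat using (ℕ; zero; suc; NonZero) renaming (_*_ to _*ℕ_)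
open import Data.Nat.Properties using (m*n≢0)
open import Data.Integer using (ℤ; +_; _+_; _%ℕ_)
open import Data.Fin using (Fin; toℕ)
open import Data.Product using (∃-syntax; _×_)
open import Relation.Unary using (Pred; ∅; _∪_; _∩_; _∖_; ⋃)
open import Relation.Binary.PropositionalEquality using (_≡_)

-- X^[α] = { z mod α : z ∈ X } ⊆ [0, α), viewed as a subset of ℤ.
red : (α : ℕ) → .{{NonZero α}} → Pred ℤ 0ℓ → Pred ℤ 0ℓ
red α X r = ∃[ z ] (X z × r ≡ + (z %ℕ α))

shift : ℤ → Pred ℤ 0ℓ → Pred ℤ 0ℓ
shift t X x = ∃[ z ] (X z × x ≡ t + z)

module Construction (a b : ℕ) .{{_ : NonZero a}} .{{_ : NonZero b}}
                    (A B : Pred ℤ 0ℓ) where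

  ab : ℕ
  ab = a *ℕ b

  instance
    ab≢0 : NonZero ab
    ab≢0 = m*n≢0 a b

  mutual
    U : ℕ → Pred ℤ 0ℓ
    U zero = ∅
    U (suc i) = U i ∪ red a (D i)

    Y : ℕ → Pred ℤ 0ℓ
    Y i = shift (+ (i *ℕ a)) (red a B ∖ U i)

    D : ℕ → Pred ℤ 0ℓ
    D i = red ab A ∩ Y i

  bigD : Pred ℤ 0ℓ
  bigD = ⋃ (Fin b) (λ i → D (toℕ i))

-- Take r ∈ A^[a] ∩ B^[a], witnessed by x ∈ A with x ≡ r (mod a), and write
-- n = x mod ab as n = i a + r, so that i < b. Either r already lies in
-- D_j^[a] for some j < i, or r ∈ B^[a] ∖ ⋃_{j<i} D_j^[a]; then n ∈ A^[ab] ∩ Y_i = D_i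
-- and n ≡ r (mod a). Deciding between the two cases is where excluded middle
-- is used. Conversely, as a divides ab and i a, reducing an element of
-- A^[ab] or of i a + B^[a] modulo a lands in A^[a] or B^[a] respectively.
module Submission where

open import Defs
open import Level using (0ℓ)
open import Data.Nat as ℕ using (ℕ; NonZero; suc; _<_; _/_; _%_)
import Data.Nat.Properties as ℕ
open import Data.Nat.DivMod using (m%n<n; m≡m%n+[m/n]*n; m<n*o⇒m/o<n)
open import Data.Integer using (ℤ; +_; _+_; _*_; _-_; ∣_∣; _%ℕ_; _/ℕ_)
import Data.Integer.Properties as ℤ
open import Data.Integer.DivMod using (a≡a%ℕn+[a/ℕn]*n; n%ℕd<d)
open import Data.Integer.Tactic.RingSolver using (solve-∀)
open import Data.Fin using (toℕ; fromℕ<)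
open import Data.Fin.Properties using (toℕ-fromℕ<)
open import Data.Product using (_,_; proj₁; proj₂; ∃-syntax; _×_)
open import Data.Sum using (inj₁; inj₂)
open import Function using (case_of_)
open import Relation.Nullary using (¬_; yes; no)
open import Relation.Unary using (Pred; _∩_; _⊆_; _≐_)
open import Axiom.ExcludedMiddle using (ExcludedMiddle)
open import Relation.Binary.PropositionalEquality
open ≡-Reasoning

remainder-unique : ∀ {d r r′} (q q′ : ℤ) → r < d → r′ < d →
                   + r + q * + d ≡ + r′ + q′ * + d → r ≡ r′
remainder-unique {d} {r} {r′} q q′ r<d r′<d eq =
  ℤ.+-injective (ℤ.i-j≡0⇒i≡j (+ r) (+ r′) (ℤ.∣i∣≡0⇒i≡0 ∣r-r′∣≡0))
  where
  r-r′≡[q′-q]*d : + r - + r′ ≡ (q′ - q) * + d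
  r-r′≡[q′-q]*d = begin
    + r - + r′                             ≡⟨ add-q*d (+ r) (+ r′) q (+ d) ⟩
    (+ r + q * + d) - (+ r′ + q * + d)     ≡⟨ cong (_- (+ r′ + q * + d)) eq ⟩
    (+ r′ + q′ * + d) - (+ r′ + q * + d)   ≡⟨ cancel-r′ (+ r′) q q′ (+ d) ⟩
    (q′ - q) * + d                         ∎
    where
    add-q*d : ∀ R R′ Q D → R - R′ ≡ (R + Q * D) - (R′ + Q * D)
    add-q*d = solve-∀
    cancel-r′ : ∀ R′ Q Q′ D → (R′ + Q′ * D) - (R′ + Q * D) ≡ (Q′ - Q) * D
    cancel-r′ = solve-∀

  ∣r-r′∣<d : ∣ + r - + r′ ∣ < d
  ∣r-r′∣<d rewrite ℤ.[+m]-[+n]≡m⊖n r r′ =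
    ℕ.≤-<-trans (ℤ.∣m⊝n∣≤m⊔n r r′) (ℕ.⊔-lub r<d r′<d)

  ∣r-r′∣≡∣q′-q∣*d : ∣ + r - + r′ ∣ ≡ ∣ q′ - q ∣ ℕ.* d
  ∣r-r′∣≡∣q′-q∣*d = trans (cong ∣_∣ r-r′≡[q′-q]*d) (ℤ.abs-* (q′ - q) (+ d))

  ∣q′-q∣≡0 : ∣ q′ - q ∣ ≡ 0
  ∣q′-q∣≡0 = ℕ.n<1⇒n≡0 (ℕ.*-cancelʳ-< d ∣ q′ - q ∣ 1
    (subst₂ _<_ ∣r-r′∣≡∣q′-q∣*d (sym (ℕ.*-identityˡ d)) ∣r-r′∣<d))

  ∣r-r′∣≡0 : ∣ + r - + r′ ∣ ≡ 0
  ∣r-r′∣≡0 = trans ∣r-r′∣≡∣q′-q∣*d (cong (ℕ._* d) ∣q′-q∣≡0)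

%ℕ-unique : ∀ x d .{{_ : NonZero d}} {r} (q : ℤ) → r < d → x ≡ + r + q * + d → x %ℕ d ≡ r
%ℕ-unique x d q r<d x≡r+q*d = remainder-unique (x /ℕ d) q (n%ℕd<d x d) r<d
  (trans (sym (a≡a%ℕn+[a/ℕn]*n x d)) x≡r+q*d)

i%ℕ[m*n]%m≡i%ℕm : ∀ i m n .{{_ : NonZero m}} .{{_ : NonZero (m ℕ.* n)}} →
                  i %ℕ (m ℕ.* n) % m ≡ i %ℕ m
i%ℕ[m*n]%m≡i%ℕm i m n = sym (%ℕ-unique i m (+ (k / m) + q * + n) (m%n<n k m) (begin
  i                                          ≡⟨ a≡a%ℕn+[a/ℕn]*n i (m ℕ.* n) ⟩
  + k + q * + (m ℕ.* n)                      ≡⟨ cong₂ (λ u v → u + q * v)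
                                                  (a≡a%ℕn+[a/ℕn]*n (+ k) m) (ℤ.pos-* m n) ⟩
  + (k % m) + + (k / m) * + m + q * (+ m * + n)
                                             ≡⟨ regroup (+ (k % m)) (+ (k / m)) (+ m) q (+ n) ⟩
  + (k % m) + (+ (k / m) + q * + n) * + m    ∎))
  where
  k : ℕ
  k = i %ℕ (m ℕ.* n)
  q : ℤ
  q = i /ℕ (m ℕ.* n)
  regroup : ∀ R Q M P N → R + Q * M + P * (M * N) ≡ R + (Q + P * N) * M
  regroup = solve-∀

shift-mono : ∀ t {X X′ : Pred ℤ 0ℓ} → X ⊆ X′ → shift t X ⊆ shift t X′
shift-mono t X⊆X′ (z , z∈X , x≡t+z) = z , X⊆X′ z∈X , x≡t+z

module _ {m : ℕ} .{{_ : NonZero m}} where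

  red-mono : ∀ {X X′ : Pred ℤ 0ℓ} → X ⊆ X′ → red m X ⊆ red m X′
  red-mono X⊆X′ (z , z∈X , r≡z%m) = z , X⊆X′ z∈X , r≡z%m

  red-red-* : ∀ {n} .{{_ : NonZero (m ℕ.* n)}} (X : Pred ℤ 0ℓ) →
              red m (red (m ℕ.* n) X) ⊆ red m X
  red-red-* {n} X (_ , (x , x∈X , refl) , r≡k%m) =
    x , x∈X , trans r≡k%m (cong +_ (i%ℕ[m*n]%m≡i%ℕm x m n))

  red-shift-*-red : ∀ i (X : Pred ℤ 0ℓ) → red m (shift (+ (i ℕ.* m)) (red m X)) ⊆ red m X
  red-shift-*-red i X (_ , (_ , (x , x∈X , refl) , refl) , r≡z%m) =
    x , x∈X , trans r≡z%m (cong +_ (%ℕ-unique _ m (+ i) (n%ℕd<d x m) (begin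
      + (i ℕ.* m) + + (x %ℕ m)   ≡⟨ ℤ.+-comm (+ (i ℕ.* m)) (+ (x %ℕ m)) ⟩
      + (x %ℕ m) + + (i ℕ.* m)   ≡⟨ cong (_+_ (+ (x %ℕ m))) (ℤ.pos-* i m) ⟩
      + (x %ℕ m) + + i * + m     ∎)))

module _ (a b : ℕ) .{{_ : NonZero a}} .{{_ : NonZero b}} (A B : Pred ℤ 0ℓ) where
  open Construction a b A B

  U-elim : ∀ {i r} → U i r → ∃[ j ] (j < i × red a (D j) r)
  U-elim {suc i} (inj₁ r∈U) with U-elim r∈U
  ... | j , j<i , r∈D^[a] = j , ℕ.m<n⇒m<1+n j<i , r∈D^[a]
  U-elim {suc i} (inj₂ r∈D^[a]) = i , ℕ.n<1+n i , r∈D^[a]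

  red-D⊆red-bigD : ∀ {j} → j < b → red a (D j) ⊆ red a bigD
  red-D⊆red-bigD j<b =
    red-mono λ z∈D → fromℕ< j<b , subst (λ k → D k _) (sym (toℕ-fromℕ< j<b)) z∈D

  red-D⊆red-A∩red-B : ∀ i → red a (D i) ⊆ red a A ∩ red a B
  red-D⊆red-A∩red-B i r∈D^[a] =
    red-red-* A (red-mono proj₁ r∈D^[a]) ,
    red-shift-*-red i B (red-mono (λ z∈D → shift-mono (+ (i ℕ.* a)) proj₁ (proj₂ z∈D)) r∈D^[a])

  red-bigD⊆red-A∩red-B : red a bigD ⊆ red a A ∩ red a B
  red-bigD⊆red-A∩red-B (z , (k , z∈D) , r≡z%a) = red-D⊆red-A∩red-B (toℕ k) (z , z∈D , r≡z%a)

  red-A∩red-B⊆red-bigD : ExcludedMiddle 0ℓ → red a A ∩ red a B ⊆ red a bigD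
  red-A∩red-B⊆red-bigD em {r} ((x , x∈A , r≡x%a) , r∈B^[a]) = case em {U i r} of λ where
      (yes r∈U) → let j , j<i , r∈D^[a] = U-elim r∈U in
                  red-D⊆red-bigD (ℕ.<-trans j<i i<b) r∈D^[a]
      (no r∉U)  → red-D⊆red-bigD i<b (+ n , n∈D r∉U , r≡n%a)
    where
    n : ℕ
    n = x %ℕ ab
    i : ℕ
    i = n / a

    i<b : i < b
    i<b = m<n*o⇒m/o<n (subst (n <_) (ℕ.*-comm a b) (n%ℕd<d x ab))

    r≡n%a : r ≡ + (n % a)
    r≡n%a = trans r≡x%a (cong +_ (sym (i%ℕ[m*n]%m≡i%ℕm x a b)))

    n≡i*a+r : + n ≡ + (i ℕ.* a) + r
    n≡i*a+r = begin
      + n                        ≡⟨ cong +_ (m≡m%n+[m/n]*n n a) ⟩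
      + (n % a ℕ.+ i ℕ.* a)      ≡⟨ cong +_ (ℕ.+-comm (n % a) (i ℕ.* a)) ⟩
      + (i ℕ.* a ℕ.+ n % a)      ≡⟨ ℤ.pos-+ (i ℕ.* a) (n % a) ⟩
      + (i ℕ.* a) + + (n % a)    ≡⟨ cong (_+_ (+ (i ℕ.* a))) (sym r≡n%a) ⟩
      + (i ℕ.* a) + r            ∎

    n∈D : ¬ U i r → D i (+ n)
    n∈D r∉U = (x , x∈A , refl) , r , (r∈B^[a] , r∉U) , n≡i*a+r

corollary10 : ExcludedMiddle 0ℓ →
    (a b : ℕ) .{{_ : NonZero a}} .{{_ : NonZero b}} (A B : Pred ℤ 0ℓ) →
    (red a A ∩ red a B) ≐ red a (Construction.bigD a b A B)
corollary10 em a b A B = red-A∩red-B⊆red-bigD a b A B em , red-bigD⊆red-A∩red-B a b A B
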